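{- If $G$ is a quasi-regularizable graph with $n$ vertices, then $\operatorname{avd}(G) \le \frac{2n}{3}$.
   Context: Graphs are finite and simple. A graph $G$ is quasi-regularizable if one can replace each edge of $G$ by a non-negative number of parallel copies so as to obtain a regular multigraph of minimum degree at least one (equivalently, $|S| \le |N(S)|$ for every independent set $S$, where $N(S)$ is the set of vertices adjacent to some vertex of $S$). A set $S \subseteq V(G)$ is a dominating set if every vertex is in $S$ or adjacent to a vertex of $S$; $\mathcal{D}(G)$ is the collection of dominating sets and $\operatorname{avd}(G) = \frac{1}{|\mathcal{D}(G)|}\sum_{S \in \mathcal{D}(G)} |S|$. -}

module Defs where

open import Data.Nat using (ℕ; zero; suc; _+_; _*_; _≤_; _<_)
open import Data.Bool using (Bool; true; false)
open import Data.Fin using (Fin)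
open import Data.Fin.Subset using (Subset; _∈_; ∣_∣)
open import Data.Fin.Subset.Properties using (_∈?_)
open import Data.Fin.Properties using (all?; any?)
open import Data.Vec using (Vec; []; _∷_; tabulate)
import Data.Vec as Vec
open import Data.List using (List; []; _∷_; map; _++_; filter; length)
open import Data.Nat.ListAction using (sum)
open import Data.Product using (Σ; ∃; _×_; _,_)
open import Data.Sum using (_⊎_)
open import Relation.Nullary using (Dec; ¬_)
open import Relation.Nullary.Decidable using (_⊎-dec_; _×-dec_)
open import Relation.Binary.PropositionalEquality using (_≡_)

record Graph (n : ℕ) : Set₁ where
  field
    Adj    : Fin n → Fin n → Set
    adj?   : ∀ u v → Dec (Adj u v)
    sym    : ∀ {u v} → Adj u v → Adj v u
    irrefl : ∀ {u} → ¬ Adj u u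
open Graph public

ΣFin : ∀ {n} → (Fin n → ℕ) → ℕ
ΣFin {n} f = Vec.sum (tabulate f)

-- Quasi-regularizable: replace each edge uv by w(u,v) ≥ 0 parallel copies
-- (w symmetric, zero on non-edges) to obtain a d-regular multigraph with d ≥ 1.
QuasiRegularizable : ∀ {n} → Graph n → Set
QuasiRegularizable {n} G =
  Σ (Fin n → Fin n → ℕ) λ w →
    (∀ u v → w u v ≡ w v u) ×
    (∀ u v → 0 < w u v → Adj G u v) ×
    Σ ℕ λ d → (1 ≤ d) × (∀ v → ΣFin (λ u → w v u) ≡ d)

Dominating : ∀ {n} → Graph n → Subset n → Set
Dominating {n} G S = ∀ v → v ∈ S ⊎ ∃ λ u → u ∈ S × Adj G u v

dominating? : ∀ {n} (G : Graph n) (S : Subset n) → Dec (Dominating G S)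
dominating? G S = all? λ v → (v ∈? S) ⊎-dec any? (λ u → (u ∈? S) ×-dec adj? G u v)

allSubsets : ∀ n → List (Subset n)
allSubsets zero = [] ∷ []
allSubsets (suc n) = map (true ∷_) (allSubsets n) ++ map (false ∷_) (allSubsets n)

domSets : ∀ {n} → Graph n → List (Subset n)
domSets {n} G = filter (dominating? G) (allSubsets n)

-- |𝒟(G)| and Σ_{S ∈ 𝒟(G)} |S|, so avd(G) = totalDomSize G / numDomSets G.
numDomSets : ∀ {n} → Graph n → ℕ
numDomSets G = length (domSets G)

totalDomSize : ∀ {n} → Graph n → ℕ
totalDomSize G = sum (map ∣_∣ (domSets G))

module Submission where

-- Call a member v of a dominating set S *redundant* if S - v still dominates,
-- and *essential* otherwise.  The theorem follows from two facts.
--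
-- (1) Essential members are few: if G is quasi-regularizable, every
--     dominating set has at most ∣ ∁ S ∣ essential members.  This is a
--     charging argument with the d-regular weighting w: an essential v
--     either has no neighbour in S (it then sends its whole weight, d,
--     along its edges, all of which leave S) or has a private neighbour
--     outside S (which then receives d from v alone).  Every vertex outside
--     S receives at most d, and members of S receive nothing.
-- (2) Redundancy is counted by complements: (S, v) ↦ (S - v, v) is a
--     bijection from the pairs with v a redundant member of S onto the pairs
--     (S', v) with S' dominating and v ∉ S', so summed over all dominating
--     sets, the number of redundant members equals ∑ ∣ ∁ S ∣.
--
-- With T = ∑ ∣ S ∣, C = ∑ ∣ ∁ S ∣ and N = ∣ 𝒟(G) ∣ this gives T ≤ 2 C and
-- T + C = n N, hence 3 T ≤ 2 n N.

open import Defs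
open import Data.Nat using (ℕ; zero; suc; _+_; _*_; _≤_; _<_; z≤n; z<s; >-nonZero)
open import Data.Nat.Properties
  using (≤-refl; ≤-trans; ≤-reflexive; +-mono-≤; +-monoˡ-≤; +-monoʳ-≤; m≤m+n; m≤n+m;
         +-comm; +-identityʳ; *-identityˡ; *-identityʳ; *-zeroʳ; *-comm;
         *-distribˡ-+; *-assoc; *-cancelˡ-≤; m+[n∸m]≡n; +-*-semiring; +-commutativeSemigroup; module ≤-Reasoning)
open import Data.Nat.ListAction using (sum)
open import Data.Nat.ListAction.Properties using (sum-++)
open import Data.Bool using (true; false; if_then_else_)
open import Data.Fin using (Fin; zero; suc; _≟_; punchIn)
open import Data.Fin.Properties using (¬∀⟶∃¬; any?; all?; punchInᵢ≢i)
open import Data.Fin.Subset using (Subset; _∈_; _∉_; ∣_∣; ∁; _-_; _─_; ⊥)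
open import Data.Fin.Subset.Properties
  using (_∈?_; x∈p∧x∉q⇒x∈p─q; x≢y⇒x∉⁅y⁆; ∣∁p∣≡n∸∣p∣; ∣p∣≤n; p─⊥≡p)
open import Data.Vec using ([]; _∷_)
open import Data.List using (List; []; _∷_; map; _++_; filter; length)
open import Data.List.Properties using (map-++; map-∘)
open import Data.Product using (∃; _×_; _,_)
open import Data.Sum using (inj₁; inj₂)
open import Data.Empty using (⊥-elim)
open import Function using (_∘_)
open import Relation.Nullary using (Dec; yes; no; does; ¬_)
open import Relation.Nullary.Decidable using (¬?; _×-dec_; _→-dec_; _⊎-dec_)
open import Relation.Unary using (Decidable)
open import Relation.Binary.PropositionalEquality
  using (_≡_; _≢_; refl; trans; cong; cong₂; subst; subst₂; module ≡-Reasoning)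
  renaming (sym to ≡-sym)
open import Algebra.Properties.CommutativeSemigroup +-commutativeSemigroup
  using () renaming (interchange to +-interchange)
open import Algebra.Properties.Semiring.Sum +-*-semiring
  using (sum-syntax; ∑-distrib-+; ∑-comm; sum-cong-≗; sum-replicate-zero; sum-remove;
         *-distribˡ-sum; *-distribʳ-sum)
  renaming (sum to ∑)

ΣFin≡∑ : ∀ {n} (f : Fin n → ℕ) → ΣFin f ≡ ∑ f
ΣFin≡∑ {zero}  f = refl
ΣFin≡∑ {suc n} f = cong (f zero +_) (ΣFin≡∑ (f ∘ suc))

∑-mono-≤ : ∀ {n} {f g : Fin n → ℕ} → (∀ i → f i ≤ g i) → ∑ f ≤ ∑ g
∑-mono-≤ {zero}  f≤g = z≤n
∑-mono-≤ {suc n} f≤g = +-mono-≤ (f≤g zero) (∑-mono-≤ (f≤g ∘ suc))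

term≤∑ : ∀ {n} (f : Fin n → ℕ) (i : Fin n) → f i ≤ ∑ f
term≤∑ f zero    = m≤m+n (f zero) _
term≤∑ f (suc i) = ≤-trans (term≤∑ (f ∘ suc) i) (m≤n+m _ (f zero))

∑-single : ∀ {n} (f : Fin n → ℕ) (i : Fin n) → (∀ j → j ≢ i → f j ≡ 0) → ∑ f ≡ f i
∑-single {suc n} f i vanish = begin
  ∑ f                               ≡⟨ sum-remove f ⟩
  f i + ∑[ j < n ] f (punchIn i j)  ≡⟨ cong (f i +_) rest≡0 ⟩
  f i + 0                           ≡⟨ +-identityʳ (f i) ⟩
  f i                               ∎
  where
  open ≡-Reasoning
  rest≡0 : ∑[ j < n ] f (punchIn i j) ≡ 0
  rest≡0 = trans (sum-cong-≗ (λ j → vanish (punchIn i j) (punchInᵢ≢i i j))) (sum-replicate-zero n)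

sumOver : ∀ {a} {A : Set a} → List A → (A → ℕ) → ℕ
sumOver xs f = sum (map f xs)

module _ {a} {A : Set a} where

  sumOver-cong : ∀ (xs : List A) {f g : A → ℕ} → (∀ x → f x ≡ g x) → sumOver xs f ≡ sumOver xs g
  sumOver-cong []       f≡g = refl
  sumOver-cong (x ∷ xs) f≡g = cong₂ _+_ (f≡g x) (sumOver-cong xs f≡g)

  sumOver-mono : ∀ (xs : List A) {f g : A → ℕ} → (∀ x → f x ≤ g x) → sumOver xs f ≤ sumOver xs g
  sumOver-mono []       f≤g = z≤n
  sumOver-mono (x ∷ xs) f≤g = +-mono-≤ (f≤g x) (sumOver-mono xs f≤g)

  sumOver-+ : ∀ (xs : List A) (f g : A → ℕ) →
              sumOver xs (λ x → f x + g x) ≡ sumOver xs f + sumOver xs g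
  sumOver-+ []       f g = refl
  sumOver-+ (x ∷ xs) f g = begin
    (f x + g x) + sumOver xs (λ y → f y + g y)        ≡⟨ cong ((f x + g x) +_) (sumOver-+ xs f g) ⟩
    (f x + g x) + (sumOver xs f + sumOver xs g)       ≡⟨ +-interchange (f x) (g x) (sumOver xs f) (sumOver xs g) ⟩
    (f x + sumOver xs f) + (g x + sumOver xs g)       ∎
    where open ≡-Reasoning

  sumOver-*ˡ : ∀ (xs : List A) (c : ℕ) (f : A → ℕ) → sumOver xs (λ x → c * f x) ≡ c * sumOver xs f
  sumOver-*ˡ []       c f = ≡-sym (*-zeroʳ c)
  sumOver-*ˡ (x ∷ xs) c f =
    trans (cong (c * f x +_) (sumOver-*ˡ xs c f)) (≡-sym (*-distribˡ-+ c (f x) _))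

  sumOver-++ : ∀ (xs ys : List A) (f : A → ℕ) → sumOver (xs ++ ys) f ≡ sumOver xs f + sumOver ys f
  sumOver-++ xs ys f = trans (cong sum (map-++ f xs ys)) (sum-++ (map f xs) (map f ys))

  sumOver-∑ : ∀ {n} (xs : List A) (h : A → Fin n → ℕ) →
              sumOver xs (λ x → ∑ (h x)) ≡ ∑[ v < n ] sumOver xs (λ x → h x v)
  sumOver-∑ {n} []       h = ≡-sym (sum-replicate-zero n)
  sumOver-∑     (x ∷ xs) h =
    trans (cong (∑ (h x) +_) (sumOver-∑ xs h)) (≡-sym (∑-distrib-+ (h x) _))

sumOver-map : ∀ {a b} {A : Set a} {B : Set b} (g : A → B) (xs : List A) (f : B → ℕ) →
              sumOver (map g xs) f ≡ sumOver xs (f ∘ g)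
sumOver-map g xs f = cong sum (≡-sym (map-∘ xs))

⟦_⟧ : ∀ {p} {P : Set p} → Dec P → ℕ
⟦ P? ⟧ = if does P? then 1 else 0

⟦⟧-split : ∀ {p q} {P : Set p} {Q : Set q} (P? : Dec P) (Q? : Dec Q) →
           ⟦ P? ⟧ ≡ ⟦ P? ⟧ * ⟦ Q? ⟧ + ⟦ P? ⟧ * ⟦ ¬? Q? ⟧
⟦⟧-split (yes _) (yes _) = refl
⟦⟧-split (yes _) (no _)  = refl
⟦⟧-split (no _)  _       = refl

sumOver-filter : ∀ {a p} {A : Set a} {P : A → Set p} (P? : Decidable P) (f : A → ℕ) (xs : List A) →
                 sumOver (filter P? xs) f ≡ sumOver xs (λ x → ⟦ P? x ⟧ * f x)
sumOver-filter P? f []       = refl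
sumOver-filter P? f (x ∷ xs) with P? x
... | yes _ = cong₂ _+_ (≡-sym (*-identityˡ (f x))) (sumOver-filter P? f xs)
... | no _  = sumOver-filter P? f xs

length-filter : ∀ {a p} {A : Set a} {P : A → Set p} (P? : Decidable P) (xs : List A) →
                length (filter P? xs) ≡ sumOver xs (λ x → ⟦ P? x ⟧)
length-filter P? []       = refl
length-filter P? (x ∷ xs) with P? x
... | yes _ = cong suc (length-filter P? xs)
... | no _  = length-filter P? xs

∣S∣≡∑ : ∀ {n} (S : Subset n) → ∣ S ∣ ≡ ∑[ v < n ] ⟦ v ∈? S ⟧
∣S∣≡∑ []          = refl
∣S∣≡∑ (true ∷ S)  = cong suc (∣S∣≡∑ S)
∣S∣≡∑ (false ∷ S) = ∣S∣≡∑ S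

∣∁S∣≡∑ : ∀ {n} (S : Subset n) → ∣ ∁ S ∣ ≡ ∑[ v < n ] ⟦ ¬? (v ∈? S) ⟧
∣∁S∣≡∑ []          = refl
∣∁S∣≡∑ (true ∷ S)  = ∣∁S∣≡∑ S
∣∁S∣≡∑ (false ∷ S) = cong suc (∣∁S∣≡∑ S)

∣S∣+∣∁S∣≡n : ∀ {n} (S : Subset n) → ∣ S ∣ + ∣ ∁ S ∣ ≡ n
∣S∣+∣∁S∣≡n S = trans (cong (∣ S ∣ +_) (∣∁p∣≡n∸∣p∣ S)) (m+[n∸m]≡n (∣p∣≤n S))

∈-remove : ∀ {n} {S : Subset n} {v y} → y ∈ S → y ≢ v → y ∈ S - v
∈-remove y∈S y≢v = x∈p∧x∉q⇒x∈p─q y∈S (x≢y⇒x∉⁅y⁆ y≢v)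

sumOver-allSubsets : ∀ n (f : Subset (suc n) → ℕ) →
  sumOver (allSubsets (suc n)) f ≡
  sumOver (allSubsets n) (λ S → f (true ∷ S)) + sumOver (allSubsets n) (λ S → f (false ∷ S))
sumOver-allSubsets n f = trans (sumOver-++ (map (true ∷_) 𝒮) _ f)
                               (cong₂ _+_ (sumOver-map (true ∷_) 𝒮 f) (sumOver-map (false ∷_) 𝒮 f))
  where 𝒮 = allSubsets n

-- Fact (2): S ↦ S - v is a bijection from the subsets containing v onto
-- those avoiding it.
sumOver-remove : ∀ n (v : Fin n) (f : Subset n → ℕ) →
  sumOver (allSubsets n) (λ S → ⟦ v ∈? S ⟧ * f (S - v)) ≡
  sumOver (allSubsets n) (λ S → ⟦ ¬? (v ∈? S) ⟧ * f S)
sumOver-remove (suc n) zero f = begin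
  sumOver (allSubsets (suc n)) (λ S → ⟦ zero ∈? S ⟧ * f (S - zero))
    ≡⟨ sumOver-allSubsets n _ ⟩
  sumOver 𝒮 (λ S → 1 * f (false ∷ (S ─ ⊥))) + sumOver 𝒮 (λ _ → 0)
    ≡⟨ +-comm _ (sumOver 𝒮 (λ _ → 0)) ⟩
  sumOver 𝒮 (λ _ → 0) + sumOver 𝒮 (λ S → 1 * f (false ∷ (S ─ ⊥)))
    ≡⟨ cong (sumOver 𝒮 (λ _ → 0) +_) (sumOver-cong 𝒮 (λ S → cong (λ T → 1 * f (false ∷ T)) (p─⊥≡p S))) ⟩
  sumOver 𝒮 (λ _ → 0) + sumOver 𝒮 (λ S → 1 * f (false ∷ S))
    ≡⟨ sumOver-allSubsets n _ ⟨
  sumOver (allSubsets (suc n)) (λ S → ⟦ ¬? (zero ∈? S) ⟧ * f S) ∎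
  where
  open ≡-Reasoning
  𝒮 = allSubsets n
sumOver-remove (suc n) (suc v) f = begin
  sumOver (allSubsets (suc n)) (λ S → ⟦ suc v ∈? S ⟧ * f (S - suc v))
    ≡⟨ sumOver-allSubsets n _ ⟩
  sumOver 𝒮 (λ S → ⟦ v ∈? S ⟧ * f (true ∷ (S - v))) + sumOver 𝒮 (λ S → ⟦ v ∈? S ⟧ * f (false ∷ (S - v)))
    ≡⟨ cong₂ _+_ (sumOver-remove n v (f ∘ (true ∷_))) (sumOver-remove n v (f ∘ (false ∷_))) ⟩
  sumOver 𝒮 (λ S → ⟦ ¬? (v ∈? S) ⟧ * f (true ∷ S)) + sumOver 𝒮 (λ S → ⟦ ¬? (v ∈? S) ⟧ * f (false ∷ S))
    ≡⟨ sumOver-allSubsets n _ ⟨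
  sumOver (allSubsets (suc n)) (λ S → ⟦ ¬? (suc v ∈? S) ⟧ * f S) ∎
  where
  open ≡-Reasoning
  𝒮 = allSubsets n

undominated : ∀ {n} (G : Graph n) (T : Subset n) → ¬ Dominating G T →
              ∃ λ x → x ∉ T × (∀ u → u ∈ T → ¬ Adj G u x)
undominated {n} G T ¬dom with ¬∀⟶∃¬ n _ (λ x → (x ∈? T) ⊎-dec any? (λ u → (u ∈? T) ×-dec adj? G u x)) ¬dom
... | x , ¬covered = x , (¬covered ∘ inj₁) , λ u u∈T u~x → ¬covered (inj₂ (u , u∈T , u~x))

isRedundant isEssential : ∀ {n} → Graph n → Subset n → Fin n → ℕ
isRedundant G S v = ⟦ v ∈? S ⟧ * ⟦ dominating? G (S - v) ⟧
isEssential G S v = ⟦ v ∈? S ⟧ * ⟦ ¬? (dominating? G (S - v)) ⟧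

redundant essential : ∀ {n} → Graph n → Subset n → ℕ
redundant G S = ∑ (isRedundant G S)
essential G S = ∑ (isEssential G S)

module Charging {n} (G : Graph n) (w : Fin n → Fin n → ℕ)
                (w-sym : ∀ u v → w u v ≡ w v u)
                (w-adj : ∀ u v → 0 < w u v → Adj G u v)
                (d : ℕ) (w-deg : ∀ v → ΣFin (λ u → w v u) ≡ d)
                (S : Subset n) (S-dom : Dominating G S) where

  HasNeighbourIn : Fin n → Set
  HasNeighbourIn v = ∃ λ u → u ∈ S × Adj G u v

  hasNeighbourIn? : ∀ v → Dec (HasNeighbourIn v)
  hasNeighbourIn? v = any? λ u → (u ∈? S) ×-dec adj? G u v

  Private : Fin n → Fin n → Set
  Private v u = u ∉ S × Adj G v u × (∀ y → y ∈ S → Adj G u y → y ≡ v)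

  private? : ∀ v u → Dec (Private v u)
  private? v u = ¬? (u ∈? S) ×-dec adj? G v u ×-dec all? (λ y → (y ∈? S) →-dec (adj? G u y →-dec (y ≟ v)))

  w-row : ∀ v → ∑ (w v) ≡ d
  w-row v = trans (≡-sym (ΣFin≡∑ (w v))) (w-deg v)

  w≤d : ∀ v u → w v u ≤ d
  w≤d v u = subst (w v u ≤_) (w-row v) (term≤∑ (w v) u)

  w-nonadjacent : ∀ v u → ¬ Adj G v u → w v u ≡ 0
  w-nonadjacent v u ¬v~u with w v u in eq
  ... | zero  = refl
  ... | suc k = ⊥-elim (¬v~u (w-adj v u (subst (0 <_) (≡-sym eq) z<s)))

  -- If v has a neighbour in S but S - v does not dominate, then v has a
  -- private neighbour: the vertex left undominated by S - v.
  private-neighbour : ∀ v → v ∈ S → HasNeighbourIn v → ¬ Dominating G (S - v) → ∃ (Private v)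
  private-neighbour v v∈S (u′ , u′∈S , u′~v) ¬dom with undominated G (S - v) ¬dom
  ... | x , x∉S-v , lonely = x , x∉S , v~x , only-v
    where
    only-v : ∀ y → y ∈ S → Adj G x y → y ≡ v
    only-v y y∈S x~y with y ≟ v
    ... | yes y≡v = y≡v
    ... | no  y≢v = ⊥-elim (lonely y (∈-remove y∈S y≢v) (Graph.sym G x~y))

    x∉S : x ∉ S
    x∉S x∈S with x ≟ v
    ... | no  x≢v = x∉S-v (∈-remove x∈S x≢v)
    ... | yes refl = Graph.irrefl G (subst (λ z → Adj G z x) (only-v u′ u′∈S (Graph.sym G u′~v)) u′~v)

    v~x : Adj G v x
    v~x with S-dom x
    ... | inj₁ x∈S            = ⊥-elim (x∉S x∈S)
    ... | inj₂ (u , u∈S , u~x) = subst (λ z → Adj G z x) (only-v u u∈S (Graph.sym G u~x)) u~x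

  Decisions : Fin n → Fin n → Set
  Decisions v u = Dec (v ∈ S) × Dec (HasNeighbourIn v) × Dec (Private v u)

  decide : ∀ v u → Decisions v u
  decide v u = (v ∈? S) , hasNeighbourIn? v , private? v u

  chargeWith : ∀ {v u} → Decisions v u → ℕ
  chargeWith         (no _  , _     , _)     = 0
  chargeWith {v} {u} (yes _ , no _  , _)     = w v u
  chargeWith         (yes _ , yes _ , yes _) = d
  chargeWith         (yes _ , yes _ , no _)  = 0

  charge : Fin n → Fin n → ℕ
  charge v u = chargeWith (decide v u)

  chargeWith-isolated : ∀ {v u} (D : Decisions v u) → v ∈ S → ¬ HasNeighbourIn v → chargeWith D ≡ w v u
  chargeWith-isolated (no v∉S , _      , _) v∈S ¬nb = ⊥-elim (v∉S v∈S)
  chargeWith-isolated (yes _  , no _   , _) v∈S ¬nb = refl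
  chargeWith-isolated (yes _  , yes nb , _) v∈S ¬nb = ⊥-elim (¬nb nb)

  chargeWith-private : ∀ {v u} (D : Decisions v u) → v ∈ S → HasNeighbourIn v → Private v u → chargeWith D ≡ d
  chargeWith-private (no v∉S , _      , _)     v∈S nb p = ⊥-elim (v∉S v∈S)
  chargeWith-private (yes _  , no ¬nb , _)     v∈S nb p = ⊥-elim (¬nb nb)
  chargeWith-private (yes _  , yes _  , yes _) v∈S nb p = refl
  chargeWith-private (yes _  , yes _  , no ¬p) v∈S nb p = ⊥-elim (¬p p)

  -- Members of S receive no charge: they are neither private neighbours
  -- nor adjacent to a member of S without neighbours in S.
  chargeWith-into-S : ∀ {v u} (D : Decisions v u) → u ∈ S → chargeWith D ≡ 0
  chargeWith-into-S         (no _    , _      , _)              u∈S = refl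
  chargeWith-into-S {v} {u} (yes v∈S , no ¬nb , _)              u∈S =
    w-nonadjacent v u (λ v~u → ¬nb (u , u∈S , Graph.sym G v~u))
  chargeWith-into-S         (yes _   , yes _  , yes (u∉S , _)) u∈S = ⊥-elim (u∉S u∈S)
  chargeWith-into-S         (yes _   , yes _  , no _)          u∈S = refl

  chargeWith≤d : ∀ {v u} (D : Decisions v u) → chargeWith D ≤ d
  chargeWith≤d         (no _  , _     , _)     = z≤n
  chargeWith≤d {v} {u} (yes _ , no _  , _)     = w≤d v u
  chargeWith≤d         (yes _ , yes _ , yes _) = ≤-refl
  chargeWith≤d         (yes _ , yes _ , no _)  = z≤n

  chargeWith-owner : ∀ {v u v₀} (D : Decisions v u) → Private v₀ u → v ≢ v₀ → chargeWith D ≡ 0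
  chargeWith-owner         (no _    , _     , _)                 _                 v≢v₀ = refl
  chargeWith-owner {v} {u} (yes v∈S , no _  , _)                 (_ , _ , only-v₀) v≢v₀ =
    w-nonadjacent v u (λ v~u → v≢v₀ (only-v₀ v v∈S (Graph.sym G v~u)))
  chargeWith-owner {v}     (yes v∈S , yes _ , yes (_ , v~u , _)) (_ , _ , only-v₀) v≢v₀ =
    ⊥-elim (v≢v₀ (only-v₀ v v∈S (Graph.sym G v~u)))
  chargeWith-owner         (yes _   , yes _ , no _)              _                 v≢v₀ = refl

  chargeWith≤w : ∀ {v u} (D : Decisions v u) → ¬ (v ∈ S × HasNeighbourIn v × Private v u) → chargeWith D ≤ w u v
  chargeWith≤w         (no _    , _      , _)     ¬owner = z≤n
  chargeWith≤w {v} {u} (yes _   , no _   , _)     ¬owner = ≤-reflexive (w-sym v u)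
  chargeWith≤w         (yes v∈S , yes nb , yes p) ¬owner = ⊥-elim (¬owner (v∈S , nb , p))
  chargeWith≤w         (yes _   , yes _  , no _)  ¬owner = z≤n

  sent : ∀ v → v ∈ S → ¬ Dominating G (S - v) → d ≤ ∑ (charge v)
  sent v v∈S ¬dom = by-neighbours (hasNeighbourIn? v)
    where
    by-neighbours : Dec (HasNeighbourIn v) → d ≤ ∑ (charge v)
    by-neighbours (no ¬nb) = ≤-reflexive (≡-sym (begin
      ∑ (charge v)  ≡⟨ sum-cong-≗ (λ u → chargeWith-isolated (decide v u) v∈S ¬nb) ⟩
      ∑ (w v)       ≡⟨ w-row v ⟩
      d             ∎))
      where open ≡-Reasoning
    by-neighbours (yes nb) with private-neighbour v v∈S nb ¬dom
    ... | x , p = subst (_≤ ∑ (charge v)) (chargeWith-private (decide v x) v∈S nb p) (term≤∑ (charge v) x)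

  received-outside : ∀ u → u ∉ S → ∑[ v < n ] charge v u ≤ d
  received-outside u u∉S
    with any? (λ v → (v ∈? S) ×-dec hasNeighbourIn? v ×-dec private? v u)
  ... | yes (v₀ , v₀∈S , nb₀ , p₀) = begin
    ∑[ v < n ] charge v u  ≡⟨ ∑-single (λ v → charge v u) v₀ (λ v v≢v₀ → chargeWith-owner (decide v u) p₀ v≢v₀) ⟩
    charge v₀ u            ≤⟨ chargeWith≤d (decide v₀ u) ⟩
    d                      ∎
    where open ≤-Reasoning
  ... | no ¬owned = begin
    ∑[ v < n ] charge v u  ≤⟨ ∑-mono-≤ (λ v → chargeWith≤w (decide v u) (λ owner → ¬owned (v , owner))) ⟩
    ∑ (w u)                ≡⟨ w-row u ⟩
    d                      ∎
    where open ≤-Reasoning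

  received : ∀ u → ∑[ v < n ] charge v u ≤ d * ⟦ ¬? (u ∈? S) ⟧
  received u = by-membership (u ∈? S)
    where
    by-membership : (u∈?S : Dec (u ∈ S)) → ∑[ v < n ] charge v u ≤ d * ⟦ ¬? u∈?S ⟧
    by-membership (yes u∈S) = ≤-reflexive (begin
      ∑[ v < n ] charge v u  ≡⟨ sum-cong-≗ (λ v → chargeWith-into-S (decide v u) u∈S) ⟩
      ∑[ v < n ] 0           ≡⟨ sum-replicate-zero n ⟩
      0                      ≡⟨ *-zeroʳ d ⟨
      d * 0                  ∎)
      where open ≡-Reasoning
    by-membership (no u∉S) = subst (∑[ v < n ] charge v u ≤_) (≡-sym (*-identityʳ d)) (received-outside u u∉S)

  sent-essential : ∀ v → d * isEssential G S v ≤ ∑ (charge v)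
  sent-essential v = by-cases (v ∈? S) (dominating? G (S - v))
    where
    by-cases : (v∈?S : Dec (v ∈ S)) (dom? : Dec (Dominating G (S - v))) →
               d * (⟦ v∈?S ⟧ * ⟦ ¬? dom? ⟧) ≤ ∑ (charge v)
    by-cases (no _)    _         = subst (_≤ ∑ (charge v)) (≡-sym (*-zeroʳ d)) z≤n
    by-cases (yes _)   (yes _)   = subst (_≤ ∑ (charge v)) (≡-sym (*-zeroʳ d)) z≤n
    by-cases (yes v∈S) (no ¬dom) = subst (_≤ ∑ (charge v)) (≡-sym (*-identityʳ d)) (sent v v∈S ¬dom)

  -- Fact (1), by double counting the charges (for d ≥ 1).
  essential-bound : 1 ≤ d → essential G S ≤ ∣ ∁ S ∣
  essential-bound 1≤d = *-cancelˡ-≤ d {{>-nonZero 1≤d}} (begin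
    d * essential G S                      ≡⟨ *-distribˡ-sum d (isEssential G S) ⟩
    ∑[ v < n ] (d * isEssential G S v)    ≤⟨ ∑-mono-≤ sent-essential ⟩
    ∑[ v < n ] ∑[ u < n ] charge v u       ≡⟨ ∑-comm charge ⟩
    ∑[ u < n ] ∑[ v < n ] charge v u       ≤⟨ ∑-mono-≤ received ⟩
    ∑[ u < n ] (d * ⟦ ¬? (u ∈? S) ⟧)       ≡⟨ *-distribˡ-sum d (λ u → ⟦ ¬? (u ∈? S) ⟧) ⟨
    d * ∑[ u < n ] ⟦ ¬? (u ∈? S) ⟧         ≡⟨ cong (d *_) (∣∁S∣≡∑ S) ⟨
    d * ∣ ∁ S ∣                            ∎)
    where open ≤-Reasoning

  -- Every member is redundant or essential, so ∣ S ∣ ≤ redundant + ∣ ∁ S ∣.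
  size-bound : 1 ≤ d → ∣ S ∣ ≤ redundant G S + ∣ ∁ S ∣
  size-bound 1≤d = begin
    ∣ S ∣                                   ≡⟨ ∣S∣≡∑ S ⟩
    ∑[ v < n ] ⟦ v ∈? S ⟧                   ≡⟨ sum-cong-≗ (λ v → ⟦⟧-split (v ∈? S) (dominating? G (S - v))) ⟩
    ∑[ v < n ] (isRedundant G S v + isEssential G S v)
                                            ≡⟨ ∑-distrib-+ (isRedundant G S) (isEssential G S) ⟩
    redundant G S + essential G S           ≤⟨ +-monoʳ-≤ (redundant G S) (essential-bound 1≤d) ⟩
    redundant G S + ∣ ∁ S ∣                 ∎
    where open ≤-Reasoning

module Counting {n} (G : Graph n) where

  𝒮 : List (Subset n)
  𝒮 = allSubsets n

  weight : Subset n → ℕ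
  weight S = ⟦ dominating? G S ⟧

  T C N : ℕ
  T = sumOver 𝒮 (λ S → weight S * ∣ S ∣)
  C = sumOver 𝒮 (λ S → weight S * ∣ ∁ S ∣)
  N = sumOver 𝒮 weight

  totalDomSize≡T : totalDomSize G ≡ T
  totalDomSize≡T = sumOver-filter (dominating? G) ∣_∣ 𝒮

  numDomSets≡N : numDomSets G ≡ N
  numDomSets≡N = length-filter (dominating? G) 𝒮

  T+C≡nN : T + C ≡ n * N
  T+C≡nN = begin
    T + C                                           ≡⟨ sumOver-+ 𝒮 _ _ ⟨
    sumOver 𝒮 (λ S → weight S * ∣ S ∣ + weight S * ∣ ∁ S ∣)
                                                    ≡⟨ sumOver-cong 𝒮 per-set ⟩
    sumOver 𝒮 (λ S → n * weight S)                  ≡⟨ sumOver-*ˡ 𝒮 n weight ⟩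
    n * N                                           ∎
    where
    open ≡-Reasoning
    per-set : ∀ S → weight S * ∣ S ∣ + weight S * ∣ ∁ S ∣ ≡ n * weight S
    per-set S = trans (≡-sym (*-distribˡ-+ (weight S) ∣ S ∣ ∣ ∁ S ∣))
                      (trans (cong (weight S *_) (∣S∣+∣∁S∣≡n S)) (*-comm (weight S) n))

  redundant≡C : sumOver 𝒮 (redundant G) ≡ C
  redundant≡C = begin
    sumOver 𝒮 (redundant G)
      ≡⟨ sumOver-∑ 𝒮 (λ S v → ⟦ v ∈? S ⟧ * weight (S - v)) ⟩
    ∑[ v < n ] sumOver 𝒮 (λ S → ⟦ v ∈? S ⟧ * weight (S - v))
      ≡⟨ sum-cong-≗ (λ v → sumOver-remove n v weight) ⟩
    ∑[ v < n ] sumOver 𝒮 (λ S → ⟦ ¬? (v ∈? S) ⟧ * weight S)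
      ≡⟨ sumOver-∑ 𝒮 (λ S v → ⟦ ¬? (v ∈? S) ⟧ * weight S) ⟨
    sumOver 𝒮 (λ S → ∑[ v < n ] (⟦ ¬? (v ∈? S) ⟧ * weight S))
      ≡⟨ sumOver-cong 𝒮 complement ⟩
    C ∎
    where
    open ≡-Reasoning
    complement : ∀ S → ∑[ v < n ] (⟦ ¬? (v ∈? S) ⟧ * weight S) ≡ weight S * ∣ ∁ S ∣
    complement S = begin
      ∑[ v < n ] (⟦ ¬? (v ∈? S) ⟧ * weight S)  ≡⟨ *-distribʳ-sum (weight S) (λ v → ⟦ ¬? (v ∈? S) ⟧) ⟨
      ∑[ v < n ] ⟦ ¬? (v ∈? S) ⟧ * weight S    ≡⟨ cong (_* weight S) (∣∁S∣≡∑ S) ⟨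
      ∣ ∁ S ∣ * weight S                       ≡⟨ *-comm ∣ ∁ S ∣ (weight S) ⟩
      weight S * ∣ ∁ S ∣                       ∎

  T≤2C : QuasiRegularizable G → T ≤ 2 * C
  T≤2C (w , w-sym , w-adj , d , 1≤d , w-deg) = begin
    T                                   ≤⟨ sumOver-mono 𝒮 per-set ⟩
    sumOver 𝒮 (λ S → redundant G S + weight S * ∣ ∁ S ∣)
                                        ≡⟨ sumOver-+ 𝒮 _ _ ⟩
    sumOver 𝒮 (redundant G) + C         ≡⟨ cong (_+ C) redundant≡C ⟩
    C + C                               ≡⟨ cong (C +_) (+-identityʳ C) ⟨
    2 * C                               ∎
    where
    open ≤-Reasoning
    per-set : ∀ S → weight S * ∣ S ∣ ≤ redundant G S + weight S * ∣ ∁ S ∣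
    per-set S = by-domination (dominating? G S)
      where
      by-domination : (dom? : Dec (Dominating G S)) → ⟦ dom? ⟧ * ∣ S ∣ ≤ redundant G S + ⟦ dom? ⟧ * ∣ ∁ S ∣
      by-domination (no _)      = z≤n
      by-domination (yes S-dom) =
        subst₂ (λ a b → a ≤ redundant G S + b) (≡-sym (*-identityˡ ∣ S ∣)) (≡-sym (*-identityˡ ∣ ∁ S ∣))
               (Charging.size-bound G w w-sym w-adj d w-deg S S-dom 1≤d)

three-halves : ∀ {t c m} → t ≤ 2 * c → t + c ≡ m → 3 * t ≤ 2 * m
three-halves {t} {c} {m} t≤2c t+c≡m = begin
  3 * t            ≡⟨⟩
  t + 2 * t        ≤⟨ +-monoˡ-≤ (2 * t) t≤2c ⟩
  2 * c + 2 * t    ≡⟨ +-comm (2 * c) (2 * t) ⟩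
  2 * t + 2 * c    ≡⟨ *-distribˡ-+ 2 t c ⟨
  2 * (t + c)      ≡⟨ cong (2 *_) t+c≡m ⟩
  2 * m            ∎
  where open ≤-Reasoning

theorem3p9 : (n : ℕ) (G : Graph n) → QuasiRegularizable G →
    3 * totalDomSize G ≤ (2 * n) * numDomSets G
theorem3p9 n G qr = begin
  3 * totalDomSize G       ≡⟨ cong (3 *_) totalDomSize≡T ⟩
  3 * T                    ≤⟨ three-halves (T≤2C qr) T+C≡nN ⟩
  2 * (n * N)              ≡⟨ *-assoc 2 n N ⟨
  (2 * n) * N              ≡⟨ cong ((2 * n) *_) numDomSets≡N ⟨
  (2 * n) * numDomSets G   ∎
  where
  open Counting G
  open ≤-Reasoning
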